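{- Let $d$ be a positive integer and $m = 4 - d^2$. Then $\frac{\sqrt{m}+ \sqrt{m-4}}{2}$ is a square in $\mathbb{Q}(\sqrt{m}, \sqrt{m-4})$ if and only if $d = 2(n^2 \pm 1)$ for some positive integer $n$. -}

module Defs where

open import Data.Nat as ℕ using (ℕ)
open import Data.Integer as ℤ using (ℤ; +_)
open import Data.Rational as ℚ using (ℚ; _+_; _*_; 0ℚ; ½)
open import Data.Product using (_×_; ∃)
open import Relation.Binary.PropositionalEquality using (_≡_; _≢_)

-- m = 4 - d² and m - 4 = -d², as rationals
mℚ : ℕ → ℚ
mℚ d = ℚ._/_ (+ 4 ℤ.- (+ (d ℕ.* d))) 1

kℚ : ℕ → ℚ
kℚ d = ℚ._/_ (ℤ.- (+ (d ℕ.* d))) 1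

-- An element  a + b·√m + c·√(m-4) + e·√m·√(m-4)  of the field
-- K_d = ℚ(√m, √(m-4)); every element of K_d has this form.
record K : Set where
  constructor ⟨_,_,_,_⟩
  field
    c1 cX cY cXY : ℚ
open K public

-- Multiplication, using √m² = m and √(m-4)² = m-4.
mulK : ℕ → K → K → K
mulK d ⟨ a , b , c , e ⟩ ⟨ a' , b' , c' , e' ⟩ =
  ⟨ a * a' + m * (b * b') + k * (c * c') + (m * k) * (e * e')
  , a * b' + b * a' + k * (c * e' + e * c')
  , a * c' + c * a' + m * (b * e' + e * b')
  , a * e' + e * a' + b * c' + c * b' ⟩
  where
    m = mℚ d
    k = kℚ d

-- For m ≠ 0 the family
-- 1, √m, √(m-4), √m√(m-4) is ℚ-linearly independent, so equality is
-- coefficientwise; for m = 0 (d = 2) we have √m = 0, so only the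
-- coefficients of 1 and √(m-4) matter.
_≈[_]_ : K → ℕ → K → Set
u ≈[ d ] v = (c1 u ≡ c1 v) × (cY u ≡ cY v)
           × (mℚ d ≢ 0ℚ → (cX u ≡ cX v) × (cXY u ≡ cXY v))

target : K
target = ⟨ 0ℚ , ½ , ½ , 0ℚ ⟩

IsSquare : ℕ → K → Set
IsSquare d x = ∃ λ z → mulK d z z ≈[ d ] x

-- Write √(m−4) = i·d, so that the target is (√m + i d)/2.  For d = 2(n² + ε)
-- with ε = ±1 the element z = (n/2)(1 + i) + (√m/(4n))(1 − i) works: z² is
-- √m/2 + i(n²/2 − m/(8n²)), and n²/2 − m/(8n²) = d/2 because (d − 2n²)² = 4.
-- Conversely, if z = a + b√m + c√(m−4) + e√m√(m−4) squares to the target, its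
-- coordinates at 1 and at √m√(m−4) say that
--   (a − cd − (b + ed)√(d²−4)) · (a + cd + (b − ed)√(d²−4)) = 0,
-- and for d ≠ 2 the number d² − 4 is not a rational square, so a = cs and
-- b = −es with s = ±d.  The two remaining coordinates then force t = 4cs to
-- satisfy (t² − 2s)² = 16.  A rational t with t² ∈ ℤ is an integer, and by
-- parity and size t² = 2s ± 4 leaves exactly d = 2(n² ± 1).  For d = 2 the
-- same coordinates give (4c)² = ±2.
module Submission where

open import Agda.Builtin.FromNat using (Number; fromNat)
open import Data.Integer as ℤ using (+_; -[1+_])
open import Data.Integer.GCD using (gcd)
import Data.Integer.Properties as ℤP
import Data.Integer.Tactic.RingSolver as ℤ-Ring
open import Data.List using (_∷_; [])
open import Data.Nat as ℕ using (ℕ; zero; suc; _≤_; _<_; z≤n; s≤s)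
import Data.Nat.Coprimality as Coprimality
open import Data.Nat.Divisibility using (_∣_; divides; ∣-refl)
import Data.Nat.Literals as ℕ-Literals
open import Data.Nat.Primality using (prime[2]; euclidsLemma)
import Data.Nat.Properties as ℕP
import Data.Nat.Tactic.RingSolver as ℕ-Ring
open import Data.Product using (∃-syntax; _×_; _,_)
open import Data.Rational as ℚ using (ℚ; mkℚ; ↥_; 0ℚ; ½)
import Data.Rational.Literals as ℚ-Literals
open ℚ-Literals using (fromℤ)
import Data.Rational.Properties as ℚP
open import Algebra.Properties.Group ℚP.+-0-group using (x∙y⁻¹≈ε⇒x≈y)
import Data.Rational.Unnormalised as ℚᵘ
import Data.Rational.Unnormalised.Properties as ℚᵘP
open import Data.Sum as Sum using (_⊎_; inj₁; inj₂)
open import Data.Unit using (⊤)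
open import Function.Bundles using (_⇔_; mk⇔)
open import Relation.Binary.PropositionalEquality
open import Relation.Nullary using (¬_; yes; no; contradiction)
open import Relation.Nullary.Decidable using (dec⇒maybe)
open import Tactic.RingSolver using (solve)
open import Tactic.RingSolver.Core.AlmostCommutativeRing
  using (AlmostCommutativeRing; fromCommutativeRing)

open import Defs

instance
  ℕ-number : Number ℕ
  ℕ-number = ℕ-Literals.number

  ℚ-number : Number ℚ
  ℚ-number = ℚ-Literals.number

module _ where
  open import Data.Nat using (_+_; _*_; _∸_)

  Twice[n²±1] : ℕ → Set
  Twice[n²±1] d = ∃[ n ] (1 ≤ n × (d ≡ 2 * (n * n + 1) ⊎ d ≡ 2 * (n * n ∸ 1)))

  even-square⇒even : ∀ X k → X * X ≡ 2 * k → ∃[ n ] X ≡ 2 * n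
  even-square⇒even X k X²≡2k with euclidsLemma X X prime[2] (divides k (trans X²≡2k (ℕP.*-comm 2 k)))
  ... | inj₁ (divides n X≡n*2) = n , trans X≡n*2 (ℕP.*-comm n 2)
  ... | inj₂ (divides n X≡n*2) = n , trans X≡n*2 (ℕP.*-comm n 2)

  X*X≢2 : ∀ X → X * X ≢ 2
  X*X≢2 zero ()
  X*X≢2 (suc zero) ()
  X*X≢2 X@(suc (suc _)) X²≡2 with ℕP.≤-trans (ℕP.*-mono-≤ 2≤X 2≤X) (ℕP.≤-reflexive X²≡2)
    where
    2≤X : 2 ≤ X
    2≤X = s≤s (s≤s z≤n)
  ... | s≤s (s≤s ())

  X*X≡2d+4⇒d≡2[n²∸1] : ∀ X d → X * X ≡ 2 * d + 4 → ∃[ n ] (1 ≤ n × d ≡ 2 * (n * n ∸ 1))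
  X*X≡2d+4⇒d≡2[n²∸1] X d X²≡2d+4 with even-square⇒even X (d + 2) (trans X²≡2d+4 (ℕ-Ring.solve (d ∷ [])))
  ... | n , refl = half n (ℕP.*-cancelˡ-≡ _ _ 2 (begin
    2 * (2 * (n * n)) ≡⟨ ℕ-Ring.solve (n ∷ []) ⟩
    2 * n * (2 * n)   ≡⟨ X²≡2d+4 ⟩
    2 * d + 4         ≡⟨ ℕ-Ring.solve (d ∷ []) ⟩
    2 * (d + 2)       ∎))
    where
    open ≡-Reasoning
    half : ∀ n → 2 * (n * n) ≡ d + 2 → ∃[ n ] (1 ≤ n × d ≡ 2 * (n * n ∸ 1))
    half zero 0≡d+2 = contradiction (ℕP.m+n≡0⇒n≡0 d (sym 0≡d+2)) λ ()
    half (suc m) 2n²≡d+2 = suc m , s≤s z≤n , ℕP.+-cancelʳ-≡ 2 d _ (trans (sym 2n²≡d+2) expand)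
      where
      expand : 2 * (suc m * suc m) ≡ 2 * (m + m * suc m) + 2
      expand = ℕ-Ring.solve (m ∷ [])

  X*X+4≡2d⇒d≡2[n²+1] : ∀ X d → X * X + 4 ≡ 2 * d → d ≢ 2 → ∃[ n ] (1 ≤ n × d ≡ 2 * (n * n + 1))
  X*X+4≡2d⇒d≡2[n²+1] X d X²+4≡2d d≢2 with even-square⇒even X (d ∸ 2) X²≡2[d∸2]
    where
    open ≡-Reasoning
    X²≡2[d∸2] : X * X ≡ 2 * (d ∸ 2)
    X²≡2[d∸2] = begin
      X * X          ≡⟨ ℕP.m+n∸n≡m (X * X) 4 ⟨
      X * X + 4 ∸ 4  ≡⟨ cong (_∸ 4) X²+4≡2d ⟩
      2 * d ∸ 2 * 2  ≡⟨ ℕP.*-distribˡ-∸ 2 d 2 ⟨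
      2 * (d ∸ 2)    ∎
  ... | n , refl = half n (ℕP.*-cancelˡ-≡ _ _ 2 (begin
    2 * (2 * (n * n) + 2) ≡⟨ ℕ-Ring.solve (n ∷ []) ⟩
    2 * n * (2 * n) + 4   ≡⟨ X²+4≡2d ⟩
    2 * d                 ∎))
    where
    open ≡-Reasoning
    half : ∀ n → 2 * (n * n) + 2 ≡ d → ∃[ n ] (1 ≤ n × d ≡ 2 * (n * n + 1))
    half zero 2≡d = contradiction (sym 2≡d) d≢2
    half (suc m) 2n²+2≡d = suc m , s≤s z≤n , trans (sym 2n²+2≡d) (ℕ-Ring.solve (m ∷ []))

  X*X+2d≡4⇒d≡2 : ∀ X d → 1 ≤ d → X * X + 2 * d ≡ 4 → d ≡ 2
  X*X+2d≡4⇒d≡2 X (suc zero) _ X²+2≡4 = contradiction (ℕP.+-cancelʳ-≡ 2 (X * X) 2 X²+2≡4) (X*X≢2 X)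
  X*X+2d≡4⇒d≡2 X (suc (suc zero)) _ _ = refl
  X*X+2d≡4⇒d≡2 X d@(suc (suc (suc _))) _ X²+2d≡4
    with ℕP.≤-trans (ℕP.*-monoʳ-≤ 2 3≤d) (ℕP.≤-trans (ℕP.m≤n+m (2 * d) (X * X)) (ℕP.≤-reflexive X²+2d≡4))
    where
    3≤d : 3 ≤ d
    3≤d = s≤s (s≤s (s≤s z≤n))
  ... | s≤s (s≤s (s≤s (s≤s ())))

  square-cancel-< : ∀ {m n} → m * m < n * n → m < n
  square-cancel-< m²<n² = ℕP.≰⇒> λ n≤m → ℕP.<⇒≱ m²<n² (ℕP.*-mono-≤ n≤m n≤m)

  X*X+4≡d*d⇒d≡2 : ∀ X d → X * X + 4 ≡ d * d → d ≡ 2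
  X*X+4≡d*d⇒d≡2 X d X²+4≡d² = ℕP.≤-antisym (ℕP.≤-pred (square-cancel-< d²<9)) (square-cancel-< 1<d²)
    where
    open ℕP.≤-Reasoning
    X<d : X < d
    X<d = square-cancel-< (begin-strict
      X * X     <⟨ ℕP.m<m+n (X * X) (s≤s z≤n) ⟩
      X * X + 4 ≡⟨ X²+4≡d² ⟩
      d * d     ∎)
    2X+1≤4 : 2 * X + 1 ≤ 4
    2X+1≤4 = ℕP.+-cancelˡ-≤ (X * X) _ _ (begin
      X * X + (2 * X + 1) ≡⟨ ℕ-Ring.solve (X ∷ []) ⟩
      suc X * suc X       ≤⟨ ℕP.*-mono-≤ X<d X<d ⟩
      d * d               ≡⟨ X²+4≡d² ⟨
      X * X + 4           ∎)
    X≤1 : X ≤ 1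
    X≤1 = ℕP.≤-pred (ℕP.*-cancelˡ-< 2 X 2 (subst (_≤ 4) (ℕP.+-comm (2 * X) 1) 2X+1≤4))
    d²<9 : d * d < 3 * 3
    d²<9 = begin-strict
      d * d     ≡⟨ X²+4≡d² ⟨
      X * X + 4 ≤⟨ ℕP.+-monoˡ-≤ 4 (ℕP.*-mono-≤ X≤1 X≤1) ⟩
      5         <⟨ ℕP.m<n+m 5 {4} (s≤s z≤n) ⟩
      9         ∎
    1<d² : 1 * 1 < d * d
    1<d² = begin-strict
      1         <⟨ s≤s (s≤s z≤n) ⟩
      4         ≤⟨ ℕP.m≤n+m 4 (X * X) ⟩
      X * X + 4 ≡⟨ X²+4≡d² ⟩
      d * d     ∎

module _ where
  open import Data.Rational using (_+_; _*_; _-_; -_)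

  ℚ-ring : AlmostCommutativeRing _ _
  ℚ-ring = fromCommutativeRing ℚP.+-*-commutativeRing (λ x → dec⇒maybe (0ℚ ℚP.≟ x))

  linear-combination₁ : ∀ {L R P Q} → L ≡ R → ∀ λ₁ → P ≡ Q + λ₁ * (L - R) → P ≡ Q
  linear-combination₁ {L} {P = P} {Q} refl λ₁ eq = trans eq (solve (Q ∷ λ₁ ∷ L ∷ []) ℚ-ring)

  linear-combination₂ : ∀ {L₁ R₁ L₂ R₂ P Q} → L₁ ≡ R₁ → L₂ ≡ R₂ →
    ∀ λ₁ λ₂ → P ≡ Q + λ₁ * (L₁ - R₁) + λ₂ * (L₂ - R₂) → P ≡ Q
  linear-combination₂ {L₁} {_} {L₂} {P = P} {Q} refl refl λ₁ λ₂ eq =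
    trans eq (solve (Q ∷ λ₁ ∷ L₁ ∷ λ₂ ∷ L₂ ∷ []) ℚ-ring)

  linear-combination₃ : ∀ {L₁ R₁ L₂ R₂ L₃ R₃ P Q} → L₁ ≡ R₁ → L₂ ≡ R₂ → L₃ ≡ R₃ →
    ∀ λ₁ λ₂ λ₃ → P ≡ Q + λ₁ * (L₁ - R₁) + λ₂ * (L₂ - R₂) + λ₃ * (L₃ - R₃) → P ≡ Q
  linear-combination₃ {L₁} {_} {L₂} {_} {L₃} {P = P} {Q} refl refl refl λ₁ λ₂ λ₃ eq =
    trans eq (solve (Q ∷ λ₁ ∷ L₁ ∷ λ₂ ∷ L₂ ∷ λ₃ ∷ L₃ ∷ []) ℚ-ring)

  p-q≡0⇒p≡q : ∀ p q → p - q ≡ 0ℚ → p ≡ q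
  p-q≡0⇒p≡q = x∙y⁻¹≈ε⇒x≈y

  p+r≡q⇒p≡q-r : ∀ p q r → p + r ≡ q → p ≡ q - r
  p+r≡q⇒p≡q-r p q r p+r≡q = linear-combination₁ p+r≡q 1 (solve (p ∷ q ∷ r ∷ []) ℚ-ring)

  p≡q-r⇒p+r≡q : ∀ p q r → p ≡ q - r → p + r ≡ q
  p≡q-r⇒p+r≡q p q r p≡q-r = linear-combination₁ p≡q-r 1 (solve (p ∷ q ∷ r ∷ []) ℚ-ring)

  p*q≡0⇒p≡0∨q≡0 : ∀ p q → p * q ≡ 0ℚ → p ≡ 0ℚ ⊎ q ≡ 0ℚ
  p*q≡0⇒p≡0∨q≡0 p q pq≡0 = Sum.map (ℚP.↥p≡0⇒p≡0 p) (ℚP.↥p≡0⇒p≡0 q)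
    (ℤP.i*j≡0⇒i≡0∨j≡0 (↥ p) (trans (sym (ℚP.↥-* p q)) (cong (ℤ._* normaliser) (cong ↥_ pq≡0))))
    where normaliser = gcd (↥ p ℤ.* ↥ q) (ℚ.↧ p ℤ.* ℚ.↧ q)

  p*q≡0∧q≢0⇒p≡0 : ∀ p q → p * q ≡ 0ℚ → q ≢ 0ℚ → p ≡ 0ℚ
  p*q≡0∧q≢0⇒p≡0 p q pq≡0 q≢0 = Sum.[ (λ p≡0 → p≡0) , (λ q≡0 → contradiction q≡0 q≢0) ]′
    (p*q≡0⇒p≡0∨q≡0 p q pq≡0)

  fromℤ-+ : ∀ x y → fromℤ (x ℤ.+ y) ≡ fromℤ x + fromℤ y
  fromℤ-+ x y = ℚP.toℚᵘ-injective (ℚᵘP.≃-trans (ℚᵘ.*≡* cross)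
    (ℚᵘP.≃-sym (ℚP.toℚᵘ-homo-+ (fromℤ x) (fromℤ y))))
    where
    cross : (x ℤ.+ y) ℤ.* + 1 ≡ (x ℤ.* + 1 ℤ.+ y ℤ.* + 1) ℤ.* + 1
    cross = ℤ-Ring.solve (x ∷ y ∷ [])

  fromℤ-* : ∀ x y → fromℤ (x ℤ.* y) ≡ fromℤ x * fromℤ y
  fromℤ-* x y = ℚP.toℚᵘ-injective (ℚᵘP.≃-sym (ℚP.toℚᵘ-homo-* (fromℤ x) (fromℤ y)))

  fromℤ-neg : ∀ x → fromℤ (ℤ.- x) ≡ - fromℤ x
  fromℤ-neg (+ zero)  = refl
  fromℤ-neg (+ suc n) = refl
  fromℤ-neg -[1+ n ]  = refl

  fromℕ : ℕ → ℚ
  fromℕ n = fromℤ (+ n)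

  fromℕ-+ : ∀ m n → fromℕ (m ℕ.+ n) ≡ fromℕ m + fromℕ n
  fromℕ-+ m n = trans (cong fromℤ (ℤP.pos-+ m n)) (fromℤ-+ (+ m) (+ n))

  fromℕ-* : ∀ m n → fromℕ (m ℕ.* n) ≡ fromℕ m * fromℕ n
  fromℕ-* m n = trans (cong fromℤ (ℤP.pos-* m n)) (fromℤ-* (+ m) (+ n))

  t*t≡z⇒↥t*↥t≡z : ∀ t z → t * t ≡ fromℤ z → ↥ t ℤ.* ↥ t ≡ z
  t*t≡z⇒↥t*↥t≡z t@(mkℚ n d-1 n⊥d) z t²≡z = begin
    n ℤ.* n           ≡⟨ ℤP.*-identityʳ (n ℤ.* n) ⟨
    n ℤ.* n ℤ.* + 1   ≡⟨ subst (λ D → n ℤ.* n ℤ.* + 1 ≡ z ℤ.* + (D ℕ.* D)) denominator≡1 cross ⟩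
    z ℤ.* + 1         ≡⟨ ℤP.*-identityʳ z ⟩
    z                 ∎
    where
    open ≡-Reasoning
    D = suc d-1
    cross : n ℤ.* n ℤ.* + 1 ≡ z ℤ.* + (D ℕ.* D)
    cross = ℚᵘP.drop-*≡* (ℚᵘP.≃-trans (ℚᵘP.≃-sym (ℚP.toℚᵘ-homo-* t t)) (ℚP.toℚᵘ-cong t²≡z))
    D∣∣n∣² : D ∣ ℤ.∣ n ∣ ℕ.* ℤ.∣ n ∣
    D∣∣n∣² = divides (ℤ.∣ z ∣ ℕ.* D) (begin
      ℤ.∣ n ∣ ℕ.* ℤ.∣ n ∣        ≡⟨ ℤP.abs-* n n ⟨
      ℤ.∣ n ℤ.* n ∣              ≡⟨ cong ℤ.∣_∣ (ℤP.*-identityʳ (n ℤ.* n)) ⟨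
      ℤ.∣ n ℤ.* n ℤ.* + 1 ∣      ≡⟨ cong ℤ.∣_∣ cross ⟩
      ℤ.∣ z ℤ.* + (D ℕ.* D) ∣    ≡⟨ ℤP.abs-* z (+ (D ℕ.* D)) ⟩
      ℤ.∣ z ∣ ℕ.* (D ℕ.* D)      ≡⟨ ℕP.*-assoc ℤ.∣ z ∣ D D ⟨
      ℤ.∣ z ∣ ℕ.* D ℕ.* D        ∎)
    denominator≡1 : D ≡ 1
    denominator≡1 = D⊥n (∣-refl , Coprimality.coprime-divisor D⊥n D∣∣n∣²)
      where D⊥n = Coprimality.sym (Coprimality.recompute n⊥d)

  t*t+p≡q⇒X*X+p≡q : ∀ t p q → t * t + fromℕ p ≡ fromℕ q → ∃[ X ] X ℕ.* X ℕ.+ p ≡ q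
  t*t+p≡q⇒X*X+p≡q t p q t²+p≡q = X , ℤP.+-injective (begin
    + (X ℕ.* X ℕ.+ p)           ≡⟨ ℤP.pos-+ (X ℕ.* X) p ⟩
    + (X ℕ.* X) ℤ.+ + p         ≡⟨ cong (ℤ._+ + p) (square-abs (↥ t)) ⟨
    ↥ t ℤ.* ↥ t ℤ.+ + p         ≡⟨ cong (ℤ._+ + p) (t*t≡z⇒↥t*↥t≡z t _ t²≡q-p) ⟩
    + q ℤ.- + p ℤ.+ + p         ≡⟨ i-j+j≡i (+ q) (+ p) ⟩
    + q                         ∎)
    where
    open ≡-Reasoning
    X = ℤ.∣ ↥ t ∣
    i-j+j≡i : ∀ i j → i ℤ.- j ℤ.+ j ≡ i
    i-j+j≡i = ℤ-Ring.solve-∀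
    square-abs : ∀ i → i ℤ.* i ≡ + (ℤ.∣ i ∣ ℕ.* ℤ.∣ i ∣)
    square-abs (+ m)    = sym (ℤP.pos-* m m)
    square-abs -[1+ m ] = refl
    t²≡q-p : t * t ≡ fromℤ (+ q ℤ.- + p)
    t²≡q-p = begin
      t * t                         ≡⟨ p+r≡q⇒p≡q-r (t * t) (fromℕ q) (fromℕ p) t²+p≡q ⟩
      fromℕ q - fromℕ p             ≡⟨ cong (λ x → fromℕ q + x) (fromℤ-neg (+ p)) ⟨
      fromℕ q + fromℤ (ℤ.- (+ p))   ≡⟨ fromℤ-+ (+ q) (ℤ.- (+ p)) ⟨
      fromℤ (+ q ℤ.- + p)           ∎

  t*t≡q⇒X*X≡q : ∀ t q → t * t ≡ fromℕ q → ∃[ X ] X ℕ.* X ≡ q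
  t*t≡q⇒X*X≡q t q t²≡q =
    let X , X²+0≡q = t*t+p≡q⇒X*X+p≡q t 0 q (trans (ℚP.+-identityʳ (t * t)) t²≡q)
    in  X , trans (sym (ℕP.+-identityʳ (X ℕ.* X))) X²+0≡q

  NonSquare : ℚ → Set
  NonSquare r = ∀ q → q * q ≢ r

  norm≡0⇒≡0 : ∀ {r} → NonSquare r → ∀ c e → c * c - e * e * r ≡ 0ℚ → c ≡ 0ℚ × e ≡ 0ℚ
  norm≡0⇒≡0 {r} r-nonsquare c e norm≡0 with e ℚP.≟ 0ℚ
  ... | yes refl = Sum.reduce (p*q≡0⇒p≡0∨q≡0 c c c²≡0) , refl
    where
    c²≡0 : c * c ≡ 0ℚ
    c²≡0 = linear-combination₁ norm≡0 1 (solve (c ∷ r ∷ []) ℚ-ring)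
  ... | no e≢0 = contradiction (quotient-squared (ℚ.1/ e) (ℚP.*-inverseʳ e)) (r-nonsquare (c * ℚ.1/ e))
    where
    instance _ = ℚ.≢-nonZero e≢0
    quotient-squared : ∀ w → e * w ≡ 1 → (c * w) * (c * w) ≡ r
    quotient-squared w ew≡1 =
      linear-combination₂ norm≡0 ew≡1 (w * w) (r * (e * w + 1)) (solve (c ∷ e ∷ w ∷ r ∷ []) ℚ-ring)

  quadratic-zero-product : ∀ {r} → NonSquare r → ∀ a b c e →
    a * c + b * e * r ≡ 0ℚ → a * e + b * c ≡ 0ℚ → (a ≡ 0ℚ × b ≡ 0ℚ) ⊎ (c ≡ 0ℚ × e ≡ 0ℚ)
  quadratic-zero-product {r} r-nonsquare a b c e h₁ h₂ with c * c - e * e * r ℚP.≟ 0ℚ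
  ... | yes norm≡0 = inj₂ (norm≡0⇒≡0 r-nonsquare c e norm≡0)
  ... | no norm≢0  = inj₁ (p*q≡0∧q≢0⇒p≡0 a _ a·norm≡0 norm≢0 , p*q≡0∧q≢0⇒p≡0 b _ b·norm≡0 norm≢0)
    where
    a·norm≡0 : a * (c * c - e * e * r) ≡ 0ℚ
    a·norm≡0 = linear-combination₂ h₁ h₂ c (- (e * r)) (solve (a ∷ b ∷ c ∷ e ∷ r ∷ []) ℚ-ring)
    b·norm≡0 : b * (c * c - e * e * r) ≡ 0ℚ
    b·norm≡0 = linear-combination₂ h₁ h₂ (- e) c (solve (a ∷ b ∷ c ∷ e ∷ r ∷ []) ℚ-ring)

  mℚ≡4-d² : ∀ d → mℚ d ≡ 4 - fromℕ d * fromℕ d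
  mℚ≡4-d² d = begin
    mℚ d                              ≡⟨ ℚP.↥p/↧p≡p (fromℤ (+ 4 ℤ.- + (d ℕ.* d))) ⟩
    fromℤ (+ 4 ℤ.- + (d ℕ.* d))       ≡⟨ fromℤ-+ (+ 4) (ℤ.- + (d ℕ.* d)) ⟩
    4 + fromℤ (ℤ.- + (d ℕ.* d))       ≡⟨ cong (λ x → 4 + x) (fromℤ-neg (+ (d ℕ.* d))) ⟩
    4 - fromℕ (d ℕ.* d)               ≡⟨ cong (λ x → 4 - x) (fromℕ-* d d) ⟩
    4 - fromℕ d * fromℕ d             ∎
    where open ≡-Reasoning

  kℚ≡-d² : ∀ d → kℚ d ≡ - (fromℕ d * fromℕ d)
  kℚ≡-d² d = begin
    kℚ d                     ≡⟨ ℚP.↥p/↧p≡p (fromℤ (ℤ.- + (d ℕ.* d))) ⟩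
    fromℤ (ℤ.- + (d ℕ.* d))  ≡⟨ fromℤ-neg (+ (d ℕ.* d)) ⟩
    - fromℕ (d ℕ.* d)        ≡⟨ cong -_ (fromℕ-* d d) ⟩
    - (fromℕ d * fromℕ d)    ∎
    where open ≡-Reasoning

  -- The coordinates at 1, √m, √k, √m√k of (a + b√m + c√k + e√m√k)² = target,
  -- as computed by mulK.
  SquareRootOfTarget : (m k a b c e : ℚ) → Set
  SquareRootOfTarget m k a b c e =
    (a * a + m * (b * b) + k * (c * c) + (m * k) * (e * e) ≡ 0ℚ) ×
    (a * b + b * a + k * (c * e + e * c) ≡ ½) ×
    (a * c + c * a + m * (b * e + e * b) ≡ ½) ×
    (a * e + e * a + b * c + c * b ≡ 0ℚ)

  a≡cs∧b≡-es : ∀ {m k D a b c e} → m ≡ 4 - D * D → k ≡ - (D * D) → NonSquare (D * D - 4) →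
    a * a + m * (b * b) + k * (c * c) + (m * k) * (e * e) ≡ 0ℚ →
    a * e + e * a + b * c + c * b ≡ 0ℚ →
    ∃[ s ] (s ≡ D ⊎ s ≡ - D) × a ≡ c * s × b ≡ - (e * s)
  a≡cs∧b≡-es {D = D} {a} {b} {c} {e} refl refl nonsquare h₁ h₂ = conclude
    (quadratic-zero-product nonsquare (a - c * D) (- (e * D) - b) (a + c * D) (b - e * D) rational-part √r-part)
    where
    rational-part : (a - c * D) * (a + c * D) + (- (e * D) - b) * (b - e * D) * (D * D - 4) ≡ 0ℚ
    rational-part = linear-combination₁ h₁ 1 (solve (D ∷ a ∷ b ∷ c ∷ e ∷ []) ℚ-ring)
    √r-part : (a - c * D) * (b - e * D) + (- (e * D) - b) * (a + c * D) ≡ 0ℚ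
    √r-part = linear-combination₁ h₂ (- D) (solve (D ∷ a ∷ b ∷ c ∷ e ∷ []) ℚ-ring)
    conclude : (a - c * D ≡ 0ℚ × - (e * D) - b ≡ 0ℚ) ⊎ (a + c * D ≡ 0ℚ × b - e * D ≡ 0ℚ) →
      ∃[ s ] (s ≡ D ⊎ s ≡ - D) × a ≡ c * s × b ≡ - (e * s)
    conclude (inj₁ (A≡0 , B≡0)) =
      D , inj₁ refl , p-q≡0⇒p≡q a (c * D) A≡0 , sym (p-q≡0⇒p≡q (- (e * D)) b B≡0)
    conclude (inj₂ (C≡0 , E≡0)) = - D , inj₂ refl ,
      linear-combination₁ C≡0 1 (solve (D ∷ a ∷ c ∷ []) ℚ-ring) ,
      linear-combination₁ E≡0 1 (solve (D ∷ b ∷ e ∷ []) ℚ-ring)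

  t²≡2s±4 : ∀ {m k s a b c e} → m ≡ 4 - s * s → k ≡ - (s * s) → a ≡ c * s → b ≡ - (e * s) →
    a * b + b * a + k * (c * e + e * c) ≡ ½ →
    a * c + c * a + m * (b * e + e * b) ≡ ½ →
    ∃[ t ] (t * t ≡ 2 * s + 4 ⊎ t * t + 4 ≡ 2 * s)
  t²≡2s±4 {s = s} {c = c} {e = e} refl refl refl refl h₁ h₂ =
    4 * c * s , Sum.map (p-q≡0⇒p≡q _ _) (p-q≡0⇒p≡q _ _) (p*q≡0⇒p≡0∨q≡0 _ _ product≡0)
    where
    product≡0 : ((4 * c * s) * (4 * c * s) - (2 * s + 4)) * ((4 * c * s) * (4 * c * s) + 4 - 2 * s) ≡ 0ℚ
    product≡0 = linear-combination₂ h₂ h₁ (128 * c * c * s * s * s) (- 8 * (s * s - 4) * (1 - 8 * s * s * c * e))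
      (solve (s ∷ c ∷ e ∷ []) ℚ-ring)

  ±-square : ∀ {D s} → s ≡ D ⊎ s ≡ - D → D * D ≡ s * s
  ±-square (inj₁ refl) = refl
  ±-square {D} (inj₂ refl) = solve (D ∷ []) ℚ-ring

  square-root⇒t²≡2s±4 : ∀ {m k D a b c e} → m ≡ 4 - D * D → k ≡ - (D * D) → NonSquare (D * D - 4) →
    SquareRootOfTarget m k a b c e →
    ∃[ s ] (s ≡ D ⊎ s ≡ - D) × ∃[ t ] (t * t ≡ 2 * s + 4 ⊎ t * t + 4 ≡ 2 * s)
  square-root⇒t²≡2s±4 {a = a} {b} {c} {e} m≡4-D² k≡-D² nonsquare (h₁ , hX , hY , hXY) =
    let s , s≡±D , a≡cs , b≡-es = a≡cs∧b≡-es {a = a} {b} {c} {e} m≡4-D² k≡-D² nonsquare h₁ hXY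
        D²≡s² = ±-square s≡±D
    in  s , s≡±D , t²≡2s±4 (trans m≡4-D² (cong (λ x → 4 - x) D²≡s²)) (trans k≡-D² (cong -_ D²≡s²))
                           a≡cs b≡-es hX hY

  m≡0⇒[4c]²≡±2 : ∀ {m k a b c e} → m ≡ 0ℚ → k ≡ - 4 →
    a * a + m * (b * b) + k * (c * c) + (m * k) * (e * e) ≡ 0ℚ →
    a * c + c * a + m * (b * e + e * b) ≡ ½ →
    ∃[ t ] (t * t ≡ 2 ⊎ t * t + 2 ≡ 0ℚ)
  m≡0⇒[4c]²≡±2 {a = a} {b} {c} {e} refl refl h₁ h₂ =
    4 * c , conclude (p*q≡0⇒p≡0∨q≡0 (a - 2 * c) (a + 2 * c) factored)
    where
    factored : (a - 2 * c) * (a + 2 * c) ≡ 0ℚ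
    factored = linear-combination₁ h₁ 1 (solve (a ∷ b ∷ c ∷ e ∷ []) ℚ-ring)
    conclude : a - 2 * c ≡ 0ℚ ⊎ a + 2 * c ≡ 0ℚ → 4 * c * (4 * c) ≡ 2 ⊎ 4 * c * (4 * c) + 2 ≡ 0ℚ
    conclude (inj₁ a-2c≡0) =
      inj₁ (linear-combination₂ h₂ a-2c≡0 4 (- 8 * c) (solve (a ∷ b ∷ c ∷ e ∷ []) ℚ-ring))
    conclude (inj₂ a+2c≡0) =
      inj₂ (linear-combination₂ h₂ a+2c≡0 (- 4) (8 * c) (solve (a ∷ b ∷ c ∷ e ∷ []) ℚ-ring))

  witness : ∀ {m k D N ε i j} → m ≡ 4 - D * D → k ≡ - (D * D) → D ≡ 2 * (N * N + ε) →
    ε * ε ≡ 1 → N * i ≡ 1 → D * j ≡ 1 →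
    SquareRootOfTarget m k (½ * N) (½ * ½ * i) (½ * N * j) (- (½ * ½ * i * j))
  witness {D = D} {N} {ε} {i} {j} refl refl D≡2[N²+ε] ε²≡1 Ni≡1 Dj≡1 =
    linear-combination₁ Dj≡1 (- (D * j + 1) * (½ * ½ * N * N + (4 - D * D) * ½ * ½ * ½ * ½ * i * i))
      (solve (N ∷ D ∷ i ∷ j ∷ []) ℚ-ring) ,
    linear-combination₂ Ni≡1 Dj≡1 (½ * ½ * (1 + D * D * j * j)) (½ * ½ * (D * j + 1))
      (solve (N ∷ D ∷ i ∷ j ∷ []) ℚ-ring) ,
    √k-coordinate D≡2[N²+ε] Dj≡1 ,
    solve (N ∷ i ∷ j ∷ []) ℚ-ring
    where
    √k-coordinate : ∀ {D} → D ≡ 2 * (N * N + ε) → D * j ≡ 1 →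
      ½ * N * (½ * N * j) + ½ * N * j * (½ * N)
        + (4 - D * D) * (½ * ½ * i * - (½ * ½ * i * j) + - (½ * ½ * i * j) * (½ * ½ * i)) ≡ ½
    √k-coordinate refl Dj≡1 = linear-combination₃ ε²≡1 Ni≡1 Dj≡1
      (½ * i * i * j) (½ * j * (N * N + 2 * ε) * (N * i + 1)) ½
      (solve (N ∷ ε ∷ i ∷ j ∷ []) ℚ-ring)

  fromℕ-2*+ : ∀ d r → fromℕ (2 ℕ.* d ℕ.+ r) ≡ 2 * fromℕ d + fromℕ r
  fromℕ-2*+ d r = trans (fromℕ-+ (2 ℕ.* d) r) (cong (λ x → x + fromℕ r) (fromℕ-* 2 d))

  d≢2⇒d²-4-nonsquare : ∀ {d} → d ≢ 2 → NonSquare (fromℕ d * fromℕ d - 4)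
  d≢2⇒d²-4-nonsquare {d} d≢2 x x²≡d²-4 =
    let X , X²+4≡d² = t*t+p≡q⇒X*X+p≡q x 4 (d ℕ.* d)
          (trans (p≡q-r⇒p+r≡q (x * x) _ 4 x²≡d²-4) (sym (fromℕ-* d d)))
    in  d≢2 (X*X+4≡d*d⇒d≡2 X d X²+4≡d²)

  D²-4-nonsquare⇒4-D²≢0 : ∀ {D} → NonSquare (D * D - 4) → 4 - D * D ≢ 0ℚ
  D²-4-nonsquare⇒4-D²≢0 {D} nonsquare 4-D²≡0 =
    nonsquare 0ℚ (linear-combination₁ 4-D²≡0 1 (solve (D ∷ []) ℚ-ring))

  t²≡2s±4⇒Twice[n²±1] : ∀ {d s t} → 1 ≤ d → d ≢ 2 → (s ≡ fromℕ d ⊎ s ≡ - fromℕ d) →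
    (t * t ≡ 2 * s + 4 ⊎ t * t + 4 ≡ 2 * s) → Twice[n²±1] d
  t²≡2s±4⇒Twice[n²±1] {d} {t = t} _ _ (inj₁ refl) (inj₁ t²≡2d+4) =
    let X , X²≡2d+4 = t*t≡q⇒X*X≡q t (2 ℕ.* d ℕ.+ 4) (trans t²≡2d+4 (sym (fromℕ-2*+ d 4)))
        n , 1≤n , d≡2[n²∸1] = X*X≡2d+4⇒d≡2[n²∸1] X d X²≡2d+4
    in  n , 1≤n , inj₂ d≡2[n²∸1]
  t²≡2s±4⇒Twice[n²±1] {d} {t = t} _ d≢2 (inj₁ refl) (inj₂ t²+4≡2d) =
    let X , X²+4≡2d = t*t+p≡q⇒X*X+p≡q t 4 (2 ℕ.* d) (trans t²+4≡2d (sym (fromℕ-* 2 d)))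
        n , 1≤n , d≡2[n²+1] = X*X+4≡2d⇒d≡2[n²+1] X d X²+4≡2d d≢2
    in  n , 1≤n , inj₁ d≡2[n²+1]
  t²≡2s±4⇒Twice[n²±1] {d} {t = t} 1≤d d≢2 (inj₂ refl) (inj₁ t²≡-2d+4) =
    let X , X²+2d≡4 = t*t+p≡q⇒X*X+p≡q t (2 ℕ.* d) 4
          (trans (cong (λ x → t * t + x) (fromℕ-* 2 d)) (move (t * t) (fromℕ d) t²≡-2d+4))
    in  contradiction (X*X+2d≡4⇒d≡2 X d 1≤d X²+2d≡4) d≢2
    where
    move : ∀ x y → x ≡ 2 * - y + 4 → x + 2 * y ≡ 4
    move x y h = linear-combination₁ h 1 (solve (x ∷ y ∷ []) ℚ-ring)
  t²≡2s±4⇒Twice[n²±1] {d} {t = t} _ _ (inj₂ refl) (inj₂ t²+4≡-2d) =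
    let X , X²+2d+4≡0 = t*t+p≡q⇒X*X+p≡q t (2 ℕ.* d ℕ.+ 4) 0
          (trans (cong (λ x → t * t + x) (fromℕ-2*+ d 4)) (move (t * t) (fromℕ d) t²+4≡-2d))
    in  contradiction (ℕP.m+n≡0⇒n≡0 (2 ℕ.* d) (ℕP.m+n≡0⇒n≡0 (X ℕ.* X) X²+2d+4≡0)) λ ()
    where
    move : ∀ x y → x + 4 ≡ 2 * - y → x + (2 * y + 4) ≡ 0ℚ
    move x y h = linear-combination₁ h 1 (solve (x ∷ y ∷ []) ℚ-ring)

  ¬square-root-for-2 : ¬ IsSquare 2 target
  ¬square-root-for-2 (⟨ a , b , c , e ⟩ , h₁ , hY , _) =
    let t , t²≡±2 = m≡0⇒[4c]²≡±2 {a = a} {b} {c} {e} refl refl h₁ hY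
    in  Sum.[ no-root-of-2 t , no-root-of-minus-2 t ]′ t²≡±2
    where
    no-root-of-2 : ∀ t → t * t ≢ 2
    no-root-of-2 t t²≡2 = let X , X²≡2 = t*t≡q⇒X*X≡q t 2 t²≡2 in X*X≢2 X X²≡2
    no-root-of-minus-2 : ∀ t → t * t + 2 ≢ 0ℚ
    no-root-of-minus-2 t t²+2≡0 = let X , X²+2≡0 = t*t+p≡q⇒X*X+p≡q t 2 0 t²+2≡0
      in contradiction (ℕP.m+n≡0⇒n≡0 (X ℕ.* X) X²+2≡0) λ ()

  d≢2∧square-root⇒Twice[n²±1] : ∀ {d} → 1 ≤ d → d ≢ 2 → IsSquare d target → Twice[n²±1] d
  d≢2∧square-root⇒Twice[n²±1] {d} 1≤d d≢2 (⟨ a , b , c , e ⟩ , h₁ , hY , hX∧hXY) =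
    let hX , hXY = hX∧hXY (subst (_≢ 0ℚ) (sym (mℚ≡4-d² d)) (D²-4-nonsquare⇒4-D²≢0 {fromℕ d} nonsquare))
        s , s≡±d , t , t²≡2s±4 = square-root⇒t²≡2s±4 {D = fromℕ d} {a} {b} {c} {e}
          (mℚ≡4-d² d) (kℚ≡-d² d) nonsquare (h₁ , hX , hY , hXY)
    in  t²≡2s±4⇒Twice[n²±1] {t = t} 1≤d d≢2 s≡±d t²≡2s±4
    where nonsquare = d≢2⇒d²-4-nonsquare d≢2

  square-root⇒Twice[n²±1] : ∀ {d} → 1 ≤ d → IsSquare d target → Twice[n²±1] d
  square-root⇒Twice[n²±1] {d} 1≤d z²≡target with d ℕ.≟ 2
  ... | yes refl = contradiction z²≡target ¬square-root-for-2
  ... | no d≢2   = d≢2∧square-root⇒Twice[n²±1] 1≤d d≢2 z²≡target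

  fromℕ-∸1 : ∀ {m} → 1 ≤ m → fromℕ (m ℕ.∸ 1) ≡ fromℕ m - 1
  fromℕ-∸1 {m} 1≤m = p+r≡q⇒p≡q-r (fromℕ (m ℕ.∸ 1)) (fromℕ m) 1
    (trans (sym (fromℕ-+ (m ℕ.∸ 1) 1)) (cong fromℕ (ℕP.m∸n+n≡m 1≤m)))

  Twice[n²±1]⇒d≡2[n²+ε] : ∀ {d n} → 1 ≤ n →
    d ≡ 2 ℕ.* (n ℕ.* n ℕ.+ 1) ⊎ d ≡ 2 ℕ.* (n ℕ.* n ℕ.∸ 1) →
    ∃[ ε ] (ε * ε ≡ 1 × fromℕ d ≡ 2 * (fromℕ n * fromℕ n + ε))
  Twice[n²±1]⇒d≡2[n²+ε] {n = n} _ (inj₁ refl) = 1 , refl , (begin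
    fromℕ (2 ℕ.* (n ℕ.* n ℕ.+ 1))        ≡⟨ fromℕ-* 2 (n ℕ.* n ℕ.+ 1) ⟩
    2 * fromℕ (n ℕ.* n ℕ.+ 1)            ≡⟨ cong (2 *_) (fromℕ-+ (n ℕ.* n) 1) ⟩
    2 * (fromℕ (n ℕ.* n) + 1)            ≡⟨ cong (λ x → 2 * (x + 1)) (fromℕ-* n n) ⟩
    2 * (fromℕ n * fromℕ n + 1)          ∎)
    where open ≡-Reasoning
  Twice[n²±1]⇒d≡2[n²+ε] {n = n} 1≤n (inj₂ refl) = - 1 , refl , (begin
    fromℕ (2 ℕ.* (n ℕ.* n ℕ.∸ 1))        ≡⟨ fromℕ-* 2 (n ℕ.* n ℕ.∸ 1) ⟩
    2 * fromℕ (n ℕ.* n ℕ.∸ 1)            ≡⟨ cong (2 *_) (fromℕ-∸1 (ℕP.*-mono-≤ 1≤n 1≤n)) ⟩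
    2 * (fromℕ (n ℕ.* n) - 1)            ≡⟨ cong (λ x → 2 * (x - 1)) (fromℕ-* n n) ⟩
    2 * (fromℕ n * fromℕ n - 1)          ∎)
    where open ≡-Reasoning

  Twice[n²±1]⇒square-root : ∀ {d} → 1 ≤ d → Twice[n²±1] d → IsSquare d target
  Twice[n²±1]⇒square-root {d@(suc _)} _ (n@(suc _) , 1≤n , d≡2[n²±1]) =
    let ε , ε²≡1 , D≡2[N²+ε] = Twice[n²±1]⇒d≡2[n²+ε] 1≤n d≡2[n²±1]
        h₁ , hX , hY , hXY = witness {D = D} {N} {ε} {ℚ.1/ N} {ℚ.1/ D} (mℚ≡4-d² d) (kℚ≡-d² d)
          D≡2[N²+ε] ε²≡1 (ℚP.*-inverseʳ N) (ℚP.*-inverseʳ D)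
    in  ⟨ ½ * N , ½ * ½ * ℚ.1/ N , ½ * N * ℚ.1/ D , - (½ * ½ * ℚ.1/ N * ℚ.1/ D) ⟩ ,
        h₁ , hY , λ _ → hX , hXY
    where
    N = fromℕ n
    D = fromℕ d

open import Data.Nat using (_*_; _+_; _∸_)

proposition5p2 : (d : ℕ) → 1 ≤ d → IsSquare d target ⇔ (∃[ n ] (1 ≤ n × (d ≡ 2 * (n * n + 1) ⊎ d ≡ 2 * (n * n ∸ 1))))
proposition5p2 d 1≤d = mk⇔ (square-root⇒Twice[n²±1] 1≤d) (Twice[n²±1]⇒square-root 1≤d)
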